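{- Let $p,q\geq 2$ be integers. (i) $\chi_{\mathrm{so}}(K_p\Box K_q)=pq$. (ii) If both $p$ and $q$ are odd (and at least $3$), then $\chi_{\mathrm{so}}(K_p\times K_q)=pq$. (iii) If $p$ is even and $q$ is odd, then $\chi_{\mathrm{so}}(K_p\times K_q)=q$. (iv) If both $p$ and $q$ are even, then $\chi_{\mathrm{so}}(K_p\times K_q)=\min(p,q)$.
   Context: A strong odd coloring of a simple graph $G$ is a proper vertex coloring such that for every vertex $v$ and every color $c$, the number of neighbors of $v$ colored $c$ is either $0$ or odd; $\chi_{\mathrm{so}}(G)$ is the minimum number of colors in such a coloring. For graphs $G,H$, both products have vertex set $V_G\times V_H$. Cartesian product $G\Box H$: $(g,h)(g',h')$ is an edge iff ($g=g'$ and $hh'\in E_H$) or ($gg'\in E_G$ and $h=h'$). Direct product $G\times H$: edge iff $gg'\in E_G$ and $hh'\in E_H$. $K_p$ is the complete graph on $p$ vertices. -}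

module Defs where

open import Data.Nat using (ℕ; zero; suc; _+_; _*_; _<_)
open import Data.Fin using (Fin; zero; suc; remQuot)
open import Data.Fin.Properties using (_≟_)
open import Data.Bool using (Bool; true; false; _∧_; _∨_; not; if_then_else_)
open import Data.Bool.Properties using (∧-zeroʳ)
open import Data.Empty using (⊥-elim)
open import Data.Product using (Σ; ∃; _×_; _,_)
open import Data.Sum using (_⊎_)
open import Relation.Nullary using (¬_; yes; no)
open import Relation.Nullary.Decidable using (⌊_⌋)
open import Relation.Binary.PropositionalEquality
  using (_≡_; _≢_; refl; sym; cong; cong₂)

record Graph : Set where
  field
    size      : ℕ
    adj       : Fin size → Fin size → Bool
    adj-sym   : ∀ u v → adj u v ≡ adj v u
    adj-irrefl : ∀ v → adj v v ≡ false
open Graph public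

Even : ℕ → Set
Even k = ∃ λ m → k ≡ 2 * m

Odd : ℕ → Set
Odd k = ∃ λ m → k ≡ suc (2 * m)

count : ∀ {n} → (Fin n → Bool) → ℕ
count {zero}  P = 0
count {suc n} P = (if P zero then 1 else 0) + count (λ i → P (suc i))

nbrsColoured : (G : Graph) {k : ℕ} → (Fin (size G) → Fin k) → Fin (size G) → Fin k → ℕ
nbrsColoured G col v c = count (λ u → adj G v u ∧ ⌊ col u ≟ c ⌋)

IsProper : (G : Graph) {k : ℕ} → (Fin (size G) → Fin k) → Set
IsProper G col = ∀ u v → adj G u v ≡ true → col u ≢ col v

IsStrongOdd : (G : Graph) {k : ℕ} → (Fin (size G) → Fin k) → Set
IsStrongOdd G col = IsProper G col ×
  (∀ v c → nbrsColoured G col v c ≡ 0 ⊎ Odd (nbrsColoured G col v c))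

-- G has a strong odd colouring with (at most) k colours
HasStrongOdd : Graph → ℕ → Set
HasStrongOdd G k = Σ (Fin (size G) → Fin k) (IsStrongOdd G)

χso≡ : Graph → ℕ → Set
χso≡ G m = HasStrongOdd G m × (∀ k → k < m → ¬ HasStrongOdd G k)

private
  eqb : ∀ {n} (x y : Fin n) → Bool
  eqb x y = ⌊ x ≟ y ⌋

  eqb-sym : ∀ {n} (x y : Fin n) → eqb x y ≡ eqb y x
  eqb-sym x y with x ≟ y | y ≟ x
  ... | yes _ | yes _ = refl
  ... | no _  | no _  = refl
  ... | yes e | no n  = ⊥-elim (n (sym e))
  ... | no n  | yes e = ⊥-elim (n (sym e))

  eqb-refl : ∀ {n} (x : Fin n) → eqb x x ≡ true
  eqb-refl x with x ≟ x
  ... | yes _ = refl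
  ... | no n  = ⊥-elim (n refl)

K : ℕ → Graph
K p = record
  { size = p
  ; adj = λ u v → not (eqb u v)
  ; adj-sym = λ u v → cong not (eqb-sym u v)
  ; adj-irrefl = λ v → irr v }
  where
  irr : ∀ (v : Fin p) → not (eqb v v) ≡ false
  irr v rewrite eqb-refl v = refl

-- Vertices of a product live in Fin (|G| * |H|), decoded as pairs via
-- remQuot (a bijection Fin (m * n) ≅ Fin m × Fin n, inverse combine).
pairOf : (G H : Graph) → Fin (size G * size H) → Fin (size G) × Fin (size H)
pairOf G H x = remQuot (size H) x

_□_ : Graph → Graph → Graph
G □ H = record
  { size = size G * size H
  ; adj = λ x y → a (pairOf G H x) (pairOf G H y)
  ; adj-sym = λ x y → s (pairOf G H x) (pairOf G H y)
  ; adj-irrefl = λ x → i (pairOf G H x) }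
  where
  a : Fin (size G) × Fin (size H) → Fin (size G) × Fin (size H) → Bool
  a (g , h) (g' , h') = (eqb g g' ∧ adj H h h') ∨ (adj G g g' ∧ eqb h h')
  s : ∀ x y → a x y ≡ a y x
  s (g , h) (g' , h') = cong₂ _∨_ (cong₂ _∧_ (eqb-sym g g') (adj-sym H h h'))
                                  (cong₂ _∧_ (adj-sym G g g') (eqb-sym h h'))
  i : ∀ x → a x x ≡ false
  i (g , h) rewrite adj-irrefl H h | adj-irrefl G g | ∧-zeroʳ (eqb g g) = refl

_⊗_ : Graph → Graph → Graph
G ⊗ H = record
  { size = size G * size H
  ; adj = λ x y → a (pairOf G H x) (pairOf G H y)
  ; adj-sym = λ x y → s (pairOf G H x) (pairOf G H y)
  ; adj-irrefl = λ x → i (pairOf G H x) }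
  where
  a : Fin (size G) × Fin (size H) → Fin (size G) × Fin (size H) → Bool
  a (g , h) (g' , h') = adj G g g' ∧ adj H h h'
  s : ∀ x y → a x y ≡ a y x
  s (g , h) (g' , h') = cong₂ _∧_ (adj-sym G g g') (adj-sym H h h')
  i : ∀ x → a x x ≡ false
  i (g , h) rewrite adj-irrefl G g = refl

module Submission where

-- A colouring of K p ⊗ K q is a p × q grid in which cells are adjacent when they differ in both
-- coordinates.  If a colour c occurs twice in row i, properness traps every c-cell in row i, so a
-- cell of another row sees exactly the c-cells of row i outside its own column.  This number is odd
-- at a column coloured c, and one larger at any column not coloured c; hence row i is monochromatic
-- and q is even.  So rows are injective when q is odd and columns when p is odd, and with fewer than
-- p ⊓ q colours row 0 and column 0 would both be monochromatic, giving (0 , 1) and (1 , 0) one colour.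
-- Conversely, colouring (g , h) by h is strong odd when every vertex of the first factor has odd
-- degree, since each neighbour count is that degree times a neighbour count of the second factor.
-- In K p □ K q, two cells of one colour in distinct rows and columns would be the only neighbours of
-- that colour of the cell sharing a row with the first and a column with the second.

open import Defs
open import Data.Nat using (ℕ; zero; suc; _+_; _*_; _<_; _≤_; _⊓_; s≤s)
open import Data.Nat.Properties
  using (suc-injective; +-suc; +-assoc; +-identityʳ; *-zeroʳ; even≢odd; <-≤-trans; m⊓n≤m; m⊓n≤n;
         m≤n⇒m⊓n≡m; m≥n⇒m⊓n≡n; ≤-total; +-0-commutativeMonoid; +-commutativeSemigroup; +-*-semiring)
open import Data.Nat.Tactic.RingSolver using (solve-∀)
open import Algebra.Properties.CommutativeMonoid.Sum +-0-commutativeMonoid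
  using (sum-syntax; ∑-comm; sum-cong-≗; sum-replicate-zero)
open import Algebra.Properties.Semiring.Sum +-*-semiring using (*-distribʳ-sum)
open import Algebra.Properties.CommutativeSemigroup +-commutativeSemigroup using (x∙yz≈y∙xz)
open import Data.Fin using (Fin; zero; suc; combine; _↑ˡ_; _↑ʳ_)
open import Data.Fin.Properties
  using (_≟_; remQuot-combine; combine-surjective; combine-injectiveˡ; pigeonhole; <⇒≢; <⇒notInjective)
open import Data.Bool using (Bool; true; false; _∧_; _∨_; not; if_then_else_)
open import Data.Bool.Properties using (∧-zeroʳ; ∧-identityʳ; ∧-comm; ∧-assoc)
open import Data.Product using (Σ; _×_; _,_; proj₁; proj₂; ∃₂; uncurry)
open import Data.Sum using (_⊎_; inj₁; inj₂)
open import Function using (_∘_; id; flip; Injective)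
open import Relation.Nullary using (¬_; yes; no; contradiction)
open import Relation.Nullary.Decidable using (⌊_⌋; isYes≗does; dec-true; dec-false; ⌊⌋-map′)
open import Relation.Binary.PropositionalEquality
open ≡-Reasoning

∧≡true⇒ : ∀ {a b} → a ∧ b ≡ true → a ≡ true × b ≡ true
∧≡true⇒ {true} {true} _ = refl , refl

∨≡true⇒ : ∀ {a b} → a ∨ b ≡ true → a ≡ true ⊎ b ≡ true
∨≡true⇒ {true} _ = inj₁ refl
∨≡true⇒ {false} b≡true = inj₂ b≡true

module _ {n : ℕ} {x y : Fin n} where

  ⌊≟⌋⇒≡ : ⌊ x ≟ y ⌋ ≡ true → x ≡ y
  ⌊≟⌋⇒≡ e with x ≟ y
  ... | yes x≡y = x≡y

  ≡⇒⌊≟⌋ : x ≡ y → ⌊ x ≟ y ⌋ ≡ true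
  ≡⇒⌊≟⌋ x≡y = trans (isYes≗does (x ≟ y)) (dec-true (x ≟ y) x≡y)

  ≢⇒⌊≟⌋ : x ≢ y → ⌊ x ≟ y ⌋ ≡ false
  ≢⇒⌊≟⌋ x≢y = trans (isYes≗does (x ≟ y)) (dec-false (x ≟ y) x≢y)

adj⇒≢ : ∀ G {u v} → adj G u v ≡ true → u ≢ v
adj⇒≢ G {u} uv refl with () ← trans (sym uv) (adj-irrefl G u)

≢⇒K-adj : ∀ {n} {u v : Fin n} → u ≢ v → adj (K n) u v ≡ true
≢⇒K-adj u≢v = cong not (≢⇒⌊≟⌋ u≢v)

ZeroOrOdd : ℕ → Set
ZeroOrOdd n = n ≡ 0 ⊎ Odd n

odd⇒¬odd-suc : ∀ {n} → Odd n → ¬ Odd (suc n)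
odd⇒¬odd-suc (a , refl) (b , e) = even≢odd b a (sym (suc-injective e))

even-suc⇒odd : ∀ {n} → Even (suc n) → Odd n
even-suc⇒odd (suc a , e) = a , trans (suc-injective e) (+-suc a (a + 0))

odd*odd : ∀ {m n} → Odd m → Odd n → Odd (m * n)
odd*odd (a , refl) (b , refl) = a + b + 2 * (a * b) , lemma a b
  where
  lemma : ∀ a b → suc (2 * a) * suc (2 * b) ≡ suc (2 * (a + b + 2 * (a * b)))
  lemma = solve-∀

odd*-zeroOrOdd : ∀ {m n} → Odd m → ZeroOrOdd n → ZeroOrOdd (m * n)
odd*-zeroOrOdd {m} _ (inj₁ refl) = inj₁ (*-zeroʳ m)
odd*-zeroOrOdd om (inj₂ on) = inj₂ (odd*odd om on)

nonzero-zeroOrOdd⇒odd : ∀ {m n} → n ≡ suc m → ZeroOrOdd n → Odd n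
nonzero-zeroOrOdd⇒odd refl (inj₂ o) = o

bit : Bool → ℕ
bit b = if b then 1 else 0

bit-zeroOrOdd : ∀ b → ZeroOrOdd (bit b)
bit-zeroOrOdd true = inj₂ (0 , refl)
bit-zeroOrOdd false = inj₁ refl

count-cong : ∀ {n} {P Q : Fin n → Bool} → (∀ x → P x ≡ Q x) → count P ≡ count Q
count-cong {zero} _ = refl
count-cong {suc n} P≗Q = cong₂ (λ b m → bit b + m) (P≗Q zero) (count-cong (P≗Q ∘ suc))

count-none : ∀ {n} {P : Fin n → Bool} → (∀ x → P x ≡ false) → count P ≡ 0
count-none {zero} _ = refl
count-none {suc n} P≗false rewrite P≗false zero = count-none (P≗false ∘ suc)

count-all : ∀ {n} {P : Fin n → Bool} → (∀ x → P x ≡ true) → count P ≡ n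
count-all {zero} _ = refl
count-all {suc n} P≗true rewrite P≗true zero = cong suc (count-all (P≗true ∘ suc))

-- adj (K n) i x is the Boolean i ≠ x.
count-remove : ∀ {n} (P : Fin n → Bool) i → count P ≡ bit (P i) + count (λ x → adj (K n) i x ∧ P x)
count-remove {suc n} P zero = refl
count-remove {suc n} P (suc i) = begin
  bit (P zero) + count (P ∘ suc)
    ≡⟨ cong (bit (P zero) +_) (count-remove (P ∘ suc) i) ⟩
  bit (P zero) + (bit (P (suc i)) + count (λ x → adj (K n) i x ∧ P (suc x)))
    ≡⟨ x∙yz≈y∙xz (bit (P zero)) (bit (P (suc i))) _ ⟩
  bit (P (suc i)) + (bit (P zero) + count (λ x → adj (K n) i x ∧ P (suc x)))
    ≡⟨ cong (λ m → bit (P (suc i)) + (bit (P zero) + m))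
         (count-cong (λ x → cong (λ b → not b ∧ P (suc x)) (sym (⌊⌋-map′ _ _ (i ≟ x))))) ⟩
  bit (P (suc i)) + count (λ x → adj (K (suc n)) (suc i) x ∧ P x) ∎

count-remove-true : ∀ {n} (P : Fin n → Bool) {i} → P i ≡ true →
                    count P ≡ suc (count (λ x → adj (K n) i x ∧ P x))
count-remove-true {n} P {i} Pi =
  trans (count-remove P i) (cong (λ b → bit b + count (λ x → adj (K n) i x ∧ P x)) Pi)

count-remove-false : ∀ {n} (P : Fin n → Bool) {i} → P i ≡ false →
                     count P ≡ count (λ x → adj (K n) i x ∧ P x)
count-remove-false {n} P {i} Pi =
  trans (count-remove P i) (cong (λ b → bit b + count (λ x → adj (K n) i x ∧ P x)) Pi)

count-single : ∀ {n} {P : Fin n → Bool} c → (∀ x → P x ≡ true → x ≡ c) → count P ≡ bit (P c)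
count-single {n} {P} c onlyC = begin
  count P                                      ≡⟨ count-remove P c ⟩
  bit (P c) + count (λ x → adj (K n) c x ∧ P x) ≡⟨ cong (bit (P c) +_) (count-none others) ⟩
  bit (P c) + 0                                ≡⟨ +-identityʳ _ ⟩
  bit (P c) ∎
  where
  others : ∀ x → adj (K n) c x ∧ P x ≡ false
  others x with P x in Px
  ... | false = ∧-zeroʳ _
  ... | true with refl ← onlyC x Px = cong (_∧ true) (adj-irrefl (K n) x)

count-pair : ∀ {n} {P : Fin n → Bool} {x y} → x ≢ y → (∀ u → P u ≡ true → u ≡ x ⊎ u ≡ y) →
             P x ≡ true → P y ≡ true → count P ≡ 2
count-pair {n} {P} {x} {y} x≢y onlyXY Px Py = begin
  count P         ≡⟨ count-remove-true P Px ⟩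
  suc (count Q)   ≡⟨ cong suc (count-single y onlyY) ⟩
  suc (bit (Q y)) ≡⟨ cong (suc ∘ bit) (cong₂ _∧_ (≢⇒K-adj x≢y) Py) ⟩
  2 ∎
  where
  Q : Fin n → Bool
  Q u = adj (K n) x u ∧ P u
  onlyY : ∀ u → Q u ≡ true → u ≡ y
  onlyY u Qu with ∧≡true⇒ Qu
  ... | xu , Pu with onlyXY u Pu
  ...   | inj₁ refl = contradiction refl (adj⇒≢ (K n) xu)
  ...   | inj₂ u≡y = u≡y

count≡∑ : ∀ {n} (P : Fin n → Bool) → count P ≡ ∑[ i < n ] bit (P i)
count≡∑ {zero} P = refl
count≡∑ {suc n} P = cong (bit (P zero) +_) (count≡∑ (P ∘ suc))

count-∧ˡ : ∀ {n} b (P : Fin n → Bool) → count (λ x → b ∧ P x) ≡ bit b * count P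
count-∧ˡ true P = sym (+-identityʳ _)
count-∧ˡ {n} false P = count-none {n} (λ _ → refl)

count-↑ : ∀ m {n} (P : Fin (m + n) → Bool) → count P ≡ count (P ∘ (_↑ˡ n)) + count (P ∘ (m ↑ʳ_))
count-↑ zero P = refl
count-↑ (suc m) P = trans (cong (bit (P zero) +_) (count-↑ m (P ∘ suc))) (sym (+-assoc (bit (P zero)) _ _))

count-combine : ∀ m {n} (P : Fin (m * n) → Bool) → count P ≡ ∑[ i < m ] count (λ j → P (combine i j))
count-combine zero P = refl
count-combine (suc m) {n} P =
  trans (count-↑ n P) (cong (count (P ∘ (_↑ˡ m * n)) +_) (count-combine m (P ∘ (n ↑ʳ_))))

∑-single : ∀ {n} (f : Fin n → ℕ) i → (∀ j → j ≢ i → f j ≡ 0) → ∑[ j < n ] f j ≡ f i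
∑-single {suc n} f zero vanish = begin
  f zero + ∑[ j < n ] f (suc j) ≡⟨ cong (f zero +_) (sum-cong-≗ (λ j → vanish (suc j) λ ())) ⟩
  f zero + ∑[ j < n ] 0         ≡⟨ cong (f zero +_) (sum-replicate-zero n) ⟩
  f zero + 0                    ≡⟨ +-identityʳ _ ⟩
  f zero ∎
∑-single {suc n} f (suc i) vanish =
  trans (cong (_+ ∑[ j < n ] f (suc j)) (vanish zero λ ()))
        (∑-single (f ∘ suc) i (λ j j≢i → vanish (suc j) λ { refl → j≢i refl }))

degree : (G : Graph) → Fin (size G) → ℕ
degree G v = count (adj G v)

id-strongOdd : ∀ G → IsStrongOdd G id
id-strongOdd G = (λ u v → adj⇒≢ G) , λ v c →
  subst ZeroOrOdd (sym (count-single c (λ u e → ⌊≟⌋⇒≡ (proj₂ (∧≡true⇒ e))))) (bit-zeroOrOdd _)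

injective⇒χso≡size : ∀ G →
  (∀ {k} (col : Fin (size G) → Fin k) → IsStrongOdd G col → Injective _≡_ _≡_ col) → χso≡ G (size G)
injective⇒χso≡size G inj = (id , id-strongOdd G) , λ k k<n (col , so) → <⇒notInjective k<n (inj col so)

injective-on-combine : ∀ {m n k} {col : Fin (m * n) → Fin k} →
  (∀ {g h g' h'} → col (combine g h) ≡ col (combine g' h') → g ≡ g' × h ≡ h') → Injective _≡_ _≡_ col
injective-on-combine {m} {n} inj {x} {y} e with combine-surjective {m} {n} x | combine-surjective {m} {n} y
... | g , h , refl | g' , h' , refl with refl , refl ← inj {g} {h} {g'} {h'} e = refl

-- Colourings of a direct product as grids

module _ (G H : Graph) {k : ℕ} where

  gridNbrsColoured : (Fin (size G) → Fin (size H) → Fin k) → Fin (size G) → Fin (size H) → Fin k → ℕ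
  gridNbrsColoured A g h c = ∑[ g' < size G ] count (λ h' → (adj G g g' ∧ adj H h h') ∧ ⌊ A g' h' ≟ c ⌋)

  IsStrongOddGrid : (Fin (size G) → Fin (size H) → Fin k) → Set
  IsStrongOddGrid A =
    (∀ g g' h h' → adj G g g' ≡ true → adj H h h' ≡ true → A g h ≢ A g' h') ×
    (∀ g h c → ZeroOrOdd (gridNbrsColoured A g h c))

  ⊗-adj : ∀ g g' h h' → adj (G ⊗ H) (combine g h) (combine g' h') ≡ adj G g g' ∧ adj H h h'
  ⊗-adj g g' h h' = cong₂ (λ x y → adj G (proj₁ x) (proj₁ y) ∧ adj H (proj₂ x) (proj₂ y))
                          (remQuot-combine g h) (remQuot-combine g' h')

  nbrsColoured-⊗ : ∀ (col : Fin (size G * size H) → Fin k) g h c →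
    nbrsColoured (G ⊗ H) col (combine g h) c ≡ gridNbrsColoured (λ g' h' → col (combine g' h')) g h c
  nbrsColoured-⊗ col g h c = trans (count-combine (size G) _) (sum-cong-≗ λ g' → count-cong λ h' →
    cong (_∧ ⌊ col (combine g' h') ≟ c ⌋) (⊗-adj g g' h h'))

  ⊗-strongOdd⇒grid : ∀ {col} → IsStrongOdd (G ⊗ H) col → IsStrongOddGrid (λ g h → col (combine g h))
  ⊗-strongOdd⇒grid {col} (proper , odd) =
    (λ g g' h h' gg' hh' → proper _ _ (trans (⊗-adj g g' h h') (cong₂ _∧_ gg' hh'))) ,
    (λ g h c → subst ZeroOrOdd (nbrsColoured-⊗ col g h c) (odd (combine g h) c))

  grid⇒⊗-strongOdd : ∀ {col} → IsStrongOddGrid (λ g h → col (combine g h)) → IsStrongOdd (G ⊗ H) col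
  grid⇒⊗-strongOdd {col} (proper , odd) = proper′ , odd′
    where
    proper′ : IsProper (G ⊗ H) col
    proper′ x y xy with combine-surjective {size G} {size H} x | combine-surjective {size G} {size H} y
    ... | g , h , refl | g' , h' , refl with ∧≡true⇒ (trans (sym (⊗-adj g g' h h')) xy)
    ...   | gg' , hh' = proper g g' h h' gg' hh'
    odd′ : ∀ x c → ZeroOrOdd (nbrsColoured (G ⊗ H) col x c)
    odd′ x c with combine-surjective {size G} {size H} x
    ... | g , h , refl = subst ZeroOrOdd (sym (nbrsColoured-⊗ col g h c)) (odd g h c)

  strongOddGrid-cong : ∀ {A B} → (∀ g h → A g h ≡ B g h) → IsStrongOddGrid A → IsStrongOddGrid B
  strongOddGrid-cong {A} {B} A≗B (proper , odd) =
    (λ g g' h h' gg' hh' e → proper g g' h h' gg' hh' (trans (A≗B g h) (trans e (sym (A≗B g' h'))))) ,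
    (λ g h c → subst ZeroOrOdd (nbrs≡ g h c) (odd g h c))
    where
    nbrs≡ : ∀ g h c → gridNbrsColoured A g h c ≡ gridNbrsColoured B g h c
    nbrs≡ g h c = sum-cong-≗ λ g' → count-cong λ h' →
      cong (λ z → (adj G g g' ∧ adj H h h') ∧ ⌊ z ≟ c ⌋) (A≗B g' h')

  grid⇒⊗-hasStrongOdd : ∀ {A} → IsStrongOddGrid A → HasStrongOdd (G ⊗ H) k
  grid⇒⊗-hasStrongOdd {A} sog = col , grid⇒⊗-strongOdd (strongOddGrid-cong col∘combine≗A sog)
    where
    col : Fin (size G * size H) → Fin k
    col x = uncurry A (pairOf G H x)
    col∘combine≗A : ∀ g h → A g h ≡ col (combine g h)
    col∘combine≗A g h = sym (cong (uncurry A) (remQuot-combine g h))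

gridNbrsColoured-flip : ∀ G H {k} (A : Fin (size G) → Fin (size H) → Fin k) g h c →
  gridNbrsColoured H G (flip A) h g c ≡ gridNbrsColoured G H A g h c
gridNbrsColoured-flip G H A g h c = begin
  ∑[ h' < size H ] count (λ g' → (adj H h h' ∧ adj G g g') ∧ ⌊ A g' h' ≟ c ⌋)
    ≡⟨ sum-cong-≗ (λ h' → count≡∑ (λ g' → (adj H h h' ∧ adj G g g') ∧ ⌊ A g' h' ≟ c ⌋)) ⟩
  ∑[ h' < size H ] ∑[ g' < size G ] bit ((adj H h h' ∧ adj G g g') ∧ ⌊ A g' h' ≟ c ⌋)
    ≡⟨ sym (∑-comm (λ g' h' → bit ((adj H h h' ∧ adj G g g') ∧ ⌊ A g' h' ≟ c ⌋))) ⟩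
  ∑[ g' < size G ] ∑[ h' < size H ] bit ((adj H h h' ∧ adj G g g') ∧ ⌊ A g' h' ≟ c ⌋)
    ≡⟨ sum-cong-≗ (λ g' → sum-cong-≗ λ h' →
         cong (λ b → bit (b ∧ ⌊ A g' h' ≟ c ⌋)) (∧-comm (adj H h h') (adj G g g'))) ⟩
  ∑[ g' < size G ] ∑[ h' < size H ] bit ((adj G g g' ∧ adj H h h') ∧ ⌊ A g' h' ≟ c ⌋)
    ≡⟨ sum-cong-≗ (λ g' → sym (count≡∑ (λ h' → (adj G g g' ∧ adj H h h') ∧ ⌊ A g' h' ≟ c ⌋))) ⟩
  ∑[ g' < size G ] count (λ h' → (adj G g g' ∧ adj H h h') ∧ ⌊ A g' h' ≟ c ⌋) ∎

transpose : ∀ G H {k} {A : Fin (size G) → Fin (size H) → Fin k} →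
  IsStrongOddGrid G H A → IsStrongOddGrid H G (flip A)
transpose G H {A = A} (proper , odd) =
  (λ h h' g g' hh' gg' → proper g g' h h' gg' hh') ,
  (λ h g c → subst ZeroOrOdd (sym (gridNbrsColoured-flip G H A g h c)) (odd g h c))

oddDegree⇒strongOddGrid : ∀ G H {k} {col : Fin (size H) → Fin k} →
  (∀ g → Odd (degree G g)) → IsStrongOdd H col → IsStrongOddGrid G H (λ _ h → col h)
oddDegree⇒strongOddGrid G H {col = col} oddDeg (proper , odd) =
  (λ g g' h h' _ hh' → proper h h' hh') ,
  (λ g h c → subst ZeroOrOdd (sym (nbrs≡ g h c)) (odd*-zeroOrOdd (oddDeg g) (odd h c)))
  where
  nbrs≡ : ∀ g h c → gridNbrsColoured G H (λ _ h → col h) g h c ≡ degree G g * nbrsColoured H col h c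
  nbrs≡ g h c = begin
    ∑[ g' < size G ] count (λ h' → (adj G g g' ∧ adj H h h') ∧ ⌊ col h' ≟ c ⌋)
      ≡⟨ sum-cong-≗ (λ g' → count-cong λ h' → ∧-assoc (adj G g g') (adj H h h') ⌊ col h' ≟ c ⌋) ⟩
    ∑[ g' < size G ] count (λ h' → adj G g g' ∧ (adj H h h' ∧ ⌊ col h' ≟ c ⌋))
      ≡⟨ sum-cong-≗ (λ g' → count-∧ˡ (adj G g g') (λ h' → adj H h h' ∧ ⌊ col h' ≟ c ⌋)) ⟩
    ∑[ g' < size G ] (bit (adj G g g') * nbrsColoured H col h c)
      ≡⟨ sym (*-distribʳ-sum (nbrsColoured H col h c) (λ g' → bit (adj G g g'))) ⟩
    (∑[ g' < size G ] bit (adj G g g')) * nbrsColoured H col h c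
      ≡⟨ cong (_* nbrsColoured H col h c) (sym (count≡∑ (adj G g))) ⟩
    degree G g * nbrsColoured H col h c ∎

K-degree : ∀ {n} (v : Fin n) → suc (degree (K n) v) ≡ n
K-degree {n} v = begin
  suc (degree (K n) v)                     ≡⟨ cong suc (count-cong λ x → sym (∧-identityʳ (adj (K n) v x))) ⟩
  suc (count (λ x → adj (K n) v x ∧ true)) ≡⟨ sym (count-remove-true (λ _ → true) {v} refl) ⟩
  count {n} (λ _ → true)                   ≡⟨ count-all (λ _ → refl) ⟩
  n ∎

even⇒K-oddDegree : ∀ {n} → Even n → ∀ v → Odd (degree (K n) v)
even⇒K-oddDegree ev v = even-suc⇒odd (subst Even (sym (K-degree v)) ev)

other : ∀ {n} → 2 ≤ n → (i : Fin n) → Σ (Fin n) (_≢ i)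
other (s≤s (s≤s _)) zero = suc zero , λ ()
other (s≤s (s≤s _)) (suc i) = zero , λ ()

pigeonhole-≢ : ∀ {m n} → n < m → (f : Fin m → Fin n) → ∃₂ λ x y → x ≢ y × f x ≡ f y
pigeonhole-≢ n<m f with x , y , x<y , fx≡fy ← pigeonhole n<m f = x , y , <⇒≢ x<y , fx≡fy

module CompleteGrid {p q k} {A : Fin p → Fin q → Fin k} (sog : IsStrongOddGrid (K p) (K q) A) where

  proper : ∀ {i i' j j'} → i ≢ i' → j ≢ j' → A i j ≢ A i' j'
  proper i≢i' j≢j' = proj₁ sog _ _ _ _ (≢⇒K-adj i≢i') (≢⇒K-adj j≢j')

  module RepeatInRow (2≤p : 2 ≤ p) {i j j'} (j≢j' : j ≢ j') (repeated : A i j ≡ A i j') where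

    c : Fin k
    c = A i j

    inRow : ∀ {i' j₀} → A i' j₀ ≡ c → i' ≡ i
    inRow {i'} {j₀} e with i' ≟ i | j₀ ≟ j
    ... | yes i'≡i | _        = i'≡i
    ... | no i'≢i  | no j₀≢j  = contradiction e (proper i'≢i j₀≢j)
    ... | no i'≢i  | yes refl = contradiction (trans e repeated) (proper i'≢i j≢j')

    i₀ : Fin p
    i₀ = proj₁ (other 2≤p i)

    i₀≢i : i₀ ≢ i
    i₀≢i = proj₂ (other 2≤p i)

    coloured : Fin q → Bool
    coloured j₁ = ⌊ A i j₁ ≟ c ⌋

    others : Fin q → ℕ
    others j₀ = count (λ j₁ → adj (K q) j₀ j₁ ∧ coloured j₁)

    nbrs≡others : ∀ j₀ → gridNbrsColoured (K p) (K q) A i₀ j₀ c ≡ others j₀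
    nbrs≡others j₀ = trans (∑-single _ i offRow) (count-cong λ j₁ →
      cong (λ b → (b ∧ adj (K q) j₀ j₁) ∧ coloured j₁) (≢⇒K-adj i₀≢i))
      where
      offRow : ∀ i' → i' ≢ i → count (λ j₁ → (adj (K p) i₀ i' ∧ adj (K q) j₀ j₁) ∧ ⌊ A i' j₁ ≟ c ⌋) ≡ 0
      offRow i' i'≢i = count-none {q} λ j₁ →
        trans (cong ((adj (K p) i₀ i' ∧ adj (K q) j₀ j₁) ∧_) (≢⇒⌊≟⌋ (i'≢i ∘ inRow))) (∧-zeroʳ _)

    others-odd : ∀ {j₀ m} → others j₀ ≡ suc m → Odd (others j₀)
    others-odd {j₀} e = nonzero-zeroOrOdd⇒odd e (subst ZeroOrOdd (nbrs≡others j₀) (proj₂ sog i₀ j₀ c))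

    others-j-odd : Odd (others j)
    others-j-odd = others-odd (count-remove-true (λ j₁ → adj (K q) j j₁ ∧ coloured j₁) {j'}
                                                 (cong₂ _∧_ (≢⇒K-adj j≢j') (≡⇒⌊≟⌋ (sym repeated))))

    count-coloured : count coloured ≡ suc (others j)
    count-coloured = count-remove-true coloured {j} (≡⇒⌊≟⌋ refl)

    constantRow : ∀ j₀ → A i j₀ ≡ c
    constantRow j₀ with A i j₀ ≟ c
    ... | yes e = e
    ... | no ne = contradiction (subst Odd others≡ (others-odd others≡)) (odd⇒¬odd-suc others-j-odd)
      where
      others≡ : others j₀ ≡ suc (others j)
      others≡ = trans (sym (count-remove-false coloured {j₀} (≢⇒⌊≟⌋ ne))) count-coloured

    ¬oddWidth : ¬ Odd q
    ¬oddWidth oq = odd⇒¬odd-suc others-j-odd (subst Odd q≡ oq)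
      where
      q≡ : q ≡ suc (others j)
      q≡ = trans (sym (count-all (λ j₀ → ≡⇒⌊≟⌋ (constantRow j₀)))) count-coloured

  rowInjective : 2 ≤ p → Odd q → ∀ {i j j'} → A i j ≡ A i j' → j ≡ j'
  rowInjective 2≤p oq {j = j} {j'} e with j ≟ j'
  ... | yes j≡j' = j≡j'
  ... | no j≢j' = contradiction oq (RepeatInRow.¬oddWidth 2≤p j≢j' e)

K-grid-injective : ∀ {p q k} {A : Fin p → Fin q → Fin k} → IsStrongOddGrid (K p) (K q) A →
  2 ≤ p → 2 ≤ q → Odd p → Odd q → ∀ {i j i' j'} → A i j ≡ A i' j' → i ≡ i' × j ≡ j'
K-grid-injective {p} {q} sog 2≤p 2≤q op oq {i} {j} {i'} {j'} e with i ≟ i' | j ≟ j'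
... | yes refl | _        = refl , CompleteGrid.rowInjective sog 2≤p oq e
... | no i≢i'  | yes refl = contradiction (CompleteGrid.rowInjective (transpose (K p) (K q) sog) 2≤q op e) i≢i'
... | no i≢i'  | no j≢j'  = contradiction e (CompleteGrid.proper sog i≢i' j≢j')

K-grid-¬fewerColours : ∀ {p q k} {A : Fin p → Fin q → Fin k} → IsStrongOddGrid (K p) (K q) A →
  2 ≤ p → 2 ≤ q → ¬ (k < p ⊓ q)
K-grid-¬fewerColours {p} {q} {A = A} sog 2≤p@(s≤s (s≤s _)) 2≤q@(s≤s (s≤s _)) k<p⊓q
  with j , j' , j≢j' , rowRepeat ← pigeonhole-≢ (<-≤-trans k<p⊓q (m⊓n≤n p q)) (A zero)
     | i , i' , i≢i' , colRepeat ← pigeonhole-≢ (<-≤-trans k<p⊓q (m⊓n≤m p q)) (λ i → A i zero)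
  = CompleteGrid.proper sog {zero} {suc zero} {suc zero} {zero} (λ ()) (λ ()) (begin
      A zero (suc zero) ≡⟨ row (suc zero) ⟩
      A zero j          ≡⟨ sym (row zero) ⟩
      A zero zero       ≡⟨ col zero ⟩
      A i zero          ≡⟨ sym (col (suc zero)) ⟩
      A (suc zero) zero ∎)
  where
  row : ∀ j₀ → A zero j₀ ≡ A zero j
  row = CompleteGrid.RepeatInRow.constantRow sog 2≤p j≢j' rowRepeat
  col : ∀ i₀ → A i₀ zero ≡ A i zero
  col = CompleteGrid.RepeatInRow.constantRow (transpose (K p) (K q) sog) 2≤q i≢i' colRepeat

-- Cartesian products

□-adj : ∀ {p q} (g g' : Fin p) (h h' : Fin q) → adj (K p □ K q) (combine g h) (combine g' h') ≡
        (⌊ g ≟ g' ⌋ ∧ adj (K q) h h') ∨ (adj (K p) g g' ∧ ⌊ h ≟ h' ⌋)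
□-adj {p} {q} g g' h h' =
  cong₂ (λ x y → (⌊ proj₁ x ≟ proj₁ y ⌋ ∧ adj (K q) (proj₂ x) (proj₂ y)) ∨
                 (adj (K p) (proj₁ x) (proj₁ y) ∧ ⌊ proj₂ x ≟ proj₂ y ⌋))
        (remQuot-combine g h) (remQuot-combine g' h')

□-adj⇒ : ∀ {p q} {g g' : Fin p} {h h' : Fin q} → adj (K p □ K q) (combine g h) (combine g' h') ≡ true →
         g ≡ g' ⊎ h ≡ h'
□-adj⇒ {g = g} {g'} {h} {h'} e with ∨≡true⇒ (trans (sym (□-adj g g' h h')) e)
... | inj₁ sameRow = inj₁ (⌊≟⌋⇒≡ (proj₁ (∧≡true⇒ sameRow)))
... | inj₂ sameCol = inj₂ (⌊≟⌋⇒≡ (proj₂ (∧≡true⇒ sameCol)))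

□-adj-row : ∀ {p q} (g : Fin p) {h h' : Fin q} → h ≢ h' → adj (K p □ K q) (combine g h) (combine g h') ≡ true
□-adj-row g {h} {h'} h≢h' rewrite □-adj g g h h' | ≡⇒⌊≟⌋ {x = g} refl | ≢⇒K-adj h≢h' = refl

□-adj-col : ∀ {p q} {g g' : Fin p} (h : Fin q) → g ≢ g' → adj (K p □ K q) (combine g h) (combine g' h) ≡ true
□-adj-col {g = g} {g'} h g≢g' rewrite □-adj g g' h h | ≢⇒⌊≟⌋ g≢g' | ≡⇒⌊≟⌋ {x = h} refl = refl

module CartesianComplete {p q k} {col : Fin (p * q) → Fin k} (so : IsStrongOdd (K p □ K q) col) where

  A : Fin p → Fin q → Fin k
  A g h = col (combine g h)

  rowInjective : ∀ {g h h'} → A g h ≡ A g h' → h ≡ h'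
  rowInjective {g} {h} {h'} e with h ≟ h'
  ... | yes h≡h' = h≡h'
  ... | no h≢h' = contradiction e (proj₁ so _ _ (□-adj-row g h≢h'))

  colInjective : ∀ {g g' h} → A g h ≡ A g' h → g ≡ g'
  colInjective {g} {g'} {h} e with g ≟ g'
  ... | yes g≡g' = g≡g'
  ... | no g≢g' = contradiction e (proj₁ so _ _ (□-adj-col h g≢g'))

  ¬offDiagonal : ∀ {g g' h h'} → g ≢ g' → h ≢ h' → A g h ≢ A g' h'
  ¬offDiagonal {g} {g'} {h} {h'} g≢g' h≢h' e =
    ¬zeroOrOdd-2 (subst ZeroOrOdd two (proj₂ so (combine g h') (A g h)))
    where
    ¬zeroOrOdd-2 : ¬ ZeroOrOdd 2
    ¬zeroOrOdd-2 (inj₂ odd-2) = odd⇒¬odd-suc (0 , refl) odd-2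
    onlyTwo : ∀ u → adj (K p □ K q) (combine g h') u ∧ ⌊ col u ≟ A g h ⌋ ≡ true →
              u ≡ combine g h ⊎ u ≡ combine g' h'
    onlyTwo u adjColoured with combine-surjective {p} {q} u
    ... | g₁ , h₁ , refl with ∧≡true⇒ adjColoured
    ...   | adjacent , coloured with □-adj⇒ {g = g} {g₁} {h'} {h₁} adjacent
    ...     | inj₁ refl = inj₁ (cong (combine g) (rowInjective (⌊≟⌋⇒≡ coloured)))
    ...     | inj₂ refl = inj₂ (cong (λ g₂ → combine g₂ h') (colInjective (trans (⌊≟⌋⇒≡ coloured) e)))
    two : nbrsColoured (K p □ K q) col (combine g h') (A g h) ≡ 2
    two = count-pair (g≢g' ∘ combine-injectiveˡ g h g' h') onlyTwo
            (cong₂ _∧_ (□-adj-row g (h≢h' ∘ sym)) (≡⇒⌊≟⌋ refl))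
            (cong₂ _∧_ (□-adj-col h' g≢g') (≡⇒⌊≟⌋ (sym e)))

  injective : ∀ {g h g' h'} → A g h ≡ A g' h' → g ≡ g' × h ≡ h'
  injective {g} {h} {g'} {h'} e with g ≟ g' | h ≟ h'
  ... | yes refl | _        = refl , rowInjective e
  ... | no g≢g'  | yes refl = contradiction (colInjective e) g≢g'
  ... | no g≢g'  | no h≢h'  = contradiction e (¬offDiagonal g≢g' h≢h')

χso-K□K : ∀ p q → χso≡ (K p □ K q) (p * q)
χso-K□K p q = injective⇒χso≡size (K p □ K q) λ col so →
  injective-on-combine (CartesianComplete.injective {p} {q} {col = col} so)

χso-K⊗K-odd-odd : ∀ {p q} → 2 ≤ p → 2 ≤ q → Odd p → Odd q → χso≡ (K p ⊗ K q) (p * q)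
χso-K⊗K-odd-odd {p} {q} 2≤p 2≤q op oq = injective⇒χso≡size (K p ⊗ K q) λ col so →
  injective-on-combine (K-grid-injective (⊗-strongOdd⇒grid (K p) (K q) {col = col} so) 2≤p 2≤q op oq)

hasStrongOdd-K⊗K-columns : ∀ {p} q → Even p → HasStrongOdd (K p ⊗ K q) q
hasStrongOdd-K⊗K-columns {p} q ep = grid⇒⊗-hasStrongOdd (K p) (K q)
  (oddDegree⇒strongOddGrid (K p) (K q) (even⇒K-oddDegree ep) (id-strongOdd (K q)))

hasStrongOdd-K⊗K-rows : ∀ p {q} → Even q → HasStrongOdd (K p ⊗ K q) p
hasStrongOdd-K⊗K-rows p {q} eq = grid⇒⊗-hasStrongOdd (K p) (K q)
  (transpose (K q) (K p) (oddDegree⇒strongOddGrid (K q) (K p) (even⇒K-oddDegree eq) (id-strongOdd (K p))))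

χso-K⊗K-even-odd : ∀ {p q} → 2 ≤ p → Even p → Odd q → χso≡ (K p ⊗ K q) q
χso-K⊗K-even-odd {p} {q} 2≤p@(s≤s _) ep oq =
  hasStrongOdd-K⊗K-columns q ep ,
  λ k k<q (col , so) → <⇒notInjective k<q
    (CompleteGrid.rowInjective (⊗-strongOdd⇒grid (K p) (K q) {col = col} so) 2≤p oq {i = zero})

hasStrongOdd-K⊗K-even-even : ∀ {p q} → Even p → Even q → HasStrongOdd (K p ⊗ K q) (p ⊓ q)
hasStrongOdd-K⊗K-even-even {p} {q} ep eq with ≤-total p q
... | inj₁ p≤q = subst (HasStrongOdd (K p ⊗ K q)) (sym (m≤n⇒m⊓n≡m p≤q)) (hasStrongOdd-K⊗K-rows p eq)
... | inj₂ q≤p = subst (HasStrongOdd (K p ⊗ K q)) (sym (m≥n⇒m⊓n≡n q≤p)) (hasStrongOdd-K⊗K-columns q ep)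

χso-K⊗K-even-even : ∀ {p q} → 2 ≤ p → 2 ≤ q → Even p → Even q → χso≡ (K p ⊗ K q) (p ⊓ q)
χso-K⊗K-even-even {p} {q} 2≤p 2≤q ep eq =
  hasStrongOdd-K⊗K-even-even ep eq ,
  λ k k<p⊓q (col , so) →
    K-grid-¬fewerColours (⊗-strongOdd⇒grid (K p) (K q) {col = col} so) 2≤p 2≤q k<p⊓q

theorem4p4 : (p q : ℕ) → 2 ≤ p → 2 ≤ q →
    χso≡ (K p □ K q) (p * q)
    × (Odd p → Odd q → χso≡ (K p ⊗ K q) (p * q))
    × (Even p → Odd q → χso≡ (K p ⊗ K q) q)
    × (Even p → Even q → χso≡ (K p ⊗ K q) (p ⊓ q))
theorem4p4 p q 2≤p 2≤q =
  χso-K□K p q ,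
  χso-K⊗K-odd-odd 2≤p 2≤q ,
  χso-K⊗K-even-odd 2≤p ,
  χso-K⊗K-even-even 2≤p 2≤q
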